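{- Let $n$ and $k$ be integers such that $k\geq 2$ and $n\geq 3k+1$. Then $$ex_{ori}(n,\overrightarrow{S_{k,1}})\geq\left\lfloor\frac{(n+k-1)^2}{4}\right\rfloor.$$
   Context: An oriented graph is a digraph obtained from a finite simple undirected graph by choosing an orientation for each edge. For a digraph $F$, $D$ is $F$-free if it contains no subgraph isomorphic to $F$. $ex_{ori}(n,F)$ is the maximum number of arcs in an $F$-free oriented graph on $n$ vertices. $\overrightarrow{S_{k,1}}$ is the digraph with vertices $v$, $w_1,\dots,w_k$, $z_1,\dots,z_k$ and arcs $z_iw_i$, $w_iv$ ($i=1,\dots,k$), i.e. the $1$-subdivision of the in-star with $k$ leaves. -}

module Defs where

open import Data.Nat using (ℕ; zero; suc; _+_)
open import Data.Bool using (Bool; true; false; if_then_else_)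
open import Data.Fin using (Fin)
open import Data.List using (List; map; allFin; concatMap)
open import Data.Nat.ListAction using (sum)
open import Data.Product using (Σ; _×_; ∃-syntax)
open import Relation.Binary.PropositionalEquality using (_≡_)
open import Relation.Nullary using (¬_)
open import Function.Definitions using (Injective)

record OrientedGraph (n : ℕ) : Set where
  field
    arc   : Fin n → Fin n → Bool
    loopless : ∀ u → arc u u ≡ false
    oriented : ∀ u v → arc u v ≡ true → arc v u ≡ false
open OrientedGraph public

arcCount : ∀ {n} → OrientedGraph n → ℕ
arcCount {n} D =
  sum (concatMap (λ u → map (λ v → if arc D u v then 1 else 0) (allFin n)) (allFin n))

data SVert (k : ℕ) : Set where
  centre : SVert k
  w z    : Fin k → SVert k

data SArc {k : ℕ} : SVert k → SVert k → Set where
  zw : ∀ i → SArc (z i) (w i)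
  wv : ∀ i → SArc (w i) centre

ContainsSk1 : ∀ {n} → ℕ → OrientedGraph n → Set
ContainsSk1 {n} k D =
  Σ (SVert k → Fin n) λ f →
    Injective _≡_ _≡_ f × (∀ a b → SArc a b → arc D (f a) (f b) ≡ true)

Sk1-free : ∀ {n} → ℕ → OrientedGraph n → Set
Sk1-free k D = ¬ ContainsSk1 k D

-- Split the vertices into a cycle B of b = ⌊(n+k-1)/2⌋ vertices and the set A of the other
-- a = n - b. Every vertex of A dominates all of B, and every vertex of B dominates its k - 1
-- successors on the cycle, which is an orientation because 2(k - 1) < b. Only vertices of B
-- receive arcs, so the k middle vertices w_i of a copy of S_{k,1} would all be in-neighbours of
-- the centre inside B, which has only k - 1 of them. There are ab + b(k - 1) = b(n + k - 1 - b)
-- = ⌊(n+k-1)²/4⌋ arcs.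
module Submission where

open import Defs
open import Data.Nat
  using (ℕ; zero; suc; _+_; _∸_; _*_; _/_; _≤_; _≥_; _<_; _≤?_; _<?_; _≟_; z≤n; s≤s; ⌊_/2⌋; ⌈_/2⌉)
open import Data.Nat.Properties
open import Data.Nat.DivMod using (m<n*o⇒m/o<n)
open import Data.Nat.ListAction using (sum)
open import Data.Nat.ListAction.Properties using (sum-++)
open import Data.Nat.Tactic.RingSolver using (solve-∀)
open import Data.Bool using (true; if_then_else_)
open import Data.Empty using (⊥)
open import Data.Fin using (Fin; toℕ; fromℕ<)
open import Data.Fin.Properties using (any?; toℕ-fromℕ<; toℕ-injective; toℕ<n; injective⇒≤)
open import Data.List using (List; []; _∷_; map; allFin; tabulate; concatMap)
open import Data.List.Properties using (map-tabulate; map-cong)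
open import Data.Product using (Σ; _×_; _,_; proj₁; map₂; Σ-syntax)
open import Data.Sum using (_⊎_; inj₁; inj₂; [_,_])
import Data.Sum as Sum
open import Function using (_∘_)
open import Level using (0ℓ)
open import Function.Definitions using (Injective)
open import Relation.Binary.Core using (Rel)
open import Relation.Binary.Definitions using (Decidable; Asymmetric)
open import Relation.Binary.PropositionalEquality using (_≡_; refl; sym; trans; cong; cong₂; subst; module ≡-Reasoning)
open import Relation.Nullary using (Dec; yes; no; does; contradiction)
open import Relation.Nullary.Decidable using (dec-false; _×-dec_; _⊎-dec_)

∑< : ℕ → (ℕ → ℕ) → ℕ
∑< zero    f = 0
∑< (suc n) f = f 0 + ∑< n (f ∘ suc)

syntax ∑< n (λ i → e) = ∑[ i < n ] e

∑-split : ∀ m n (f : ℕ → ℕ) → ∑< (m + n) f ≡ ∑< m f + ∑[ i < n ] f (m + i)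
∑-split zero    n f = refl
∑-split (suc m) n f = trans (cong (f 0 +_) (∑-split m n (f ∘ suc))) (sym (+-assoc (f 0) _ _))

∑-distrib-+ : ∀ n (f g : ℕ → ℕ) → ∑[ i < n ] (f i + g i) ≡ ∑< n f + ∑< n g
∑-distrib-+ zero    f g = refl
∑-distrib-+ (suc n) f g =
  trans (cong (f 0 + g 0 +_) (∑-distrib-+ n (f ∘ suc) (g ∘ suc))) (+-+-interchange (f 0) (g 0) _ _ )
  where
  +-+-interchange : ∀ w x y z → (w + x) + (y + z) ≡ (w + y) + (x + z)
  +-+-interchange = solve-∀

∑-mono-≤ : ∀ n {f g : ℕ → ℕ} → (∀ i → i < n → f i ≤ g i) → ∑< n f ≤ ∑< n g
∑-mono-≤ zero    f≤g = z≤n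
∑-mono-≤ (suc n) f≤g = +-mono-≤ (f≤g 0 (s≤s z≤n)) (∑-mono-≤ n (λ i i<n → f≤g (suc i) (s≤s i<n)))

∑-const-lower : ∀ n {k} {f : ℕ → ℕ} → (∀ i → i < n → k ≤ f i) → n * k ≤ ∑< n f
∑-const-lower zero    k≤f = z≤n
∑-const-lower (suc n) k≤f = +-mono-≤ (k≤f 0 (s≤s z≤n)) (∑-const-lower n (λ i i<n → k≤f (suc i) (s≤s i<n)))

∑-window : ∀ l {len m} (f : ℕ → ℕ) → l + len ≤ m → ∑[ j < len ] f (l + j) ≤ ∑< m f
∑-window zero    f z≤n         = z≤n
∑-window zero    f (s≤s len≤m) = +-monoʳ-≤ (f 0) (∑-window zero (f ∘ suc) len≤m)
∑-window (suc l) f (s≤s l+len≤m) = ≤-trans (∑-window l (f ∘ suc) l+len≤m) (m≤n+m _ (f 0))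

𝟙 : ∀ {p} {P : Set p} → Dec P → ℕ
𝟙 P? = if does P? then 1 else 0

𝟙-+-≤ : ∀ {p q r} {P : Set p} {Q : Set q} {R : Set r} (P? : Dec P) (Q? : Dec Q) (R? : Dec R) →
        (P → R) → (Q → R) → (P → Q → ⊥) → 𝟙 P? + 𝟙 Q? ≤ 𝟙 R?
𝟙-+-≤ (yes p) (yes q) _       _   _   disjoint = contradiction q (disjoint p)
𝟙-+-≤ (yes _) (no _)  (yes _) _   _   _        = ≤-refl
𝟙-+-≤ (yes p) (no _)  (no ¬r) P⇒R _   _        = contradiction (P⇒R p) ¬r
𝟙-+-≤ (no _)  (yes _) (yes _) _   _   _        = ≤-refl
𝟙-+-≤ (no _)  (yes q) (no ¬r) _   Q⇒R _        = contradiction (Q⇒R q) ¬r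
𝟙-+-≤ (no _)  (no _)  _       _   _   _        = z≤n

count-window : ∀ {p} {P : ℕ → Set p} (P? : ∀ y → Dec (P y)) l {len m} →
               l + len ≤ m → (∀ j → j < len → P (l + j)) → len ≤ ∑[ y < m ] 𝟙 (P? y)
count-window P? l {len} {m} l+len≤m P-window = begin
  len                              ≡⟨ sym (*-identityʳ len) ⟩
  len * 1                          ≤⟨ ∑-const-lower len (λ j j<len → 𝟙-yes (P? (l + j)) (P-window j j<len)) ⟩
  ∑[ j < len ] 𝟙 (P? (l + j))      ≤⟨ ∑-window l (λ y → 𝟙 (P? y)) l+len≤m ⟩
  ∑[ y < m ] 𝟙 (P? y)              ∎
  where
  open ≤-Reasoning
  𝟙-yes : ∀ {p} {P : Set p} (P? : Dec P) → P → 1 ≤ 𝟙 P?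
  𝟙-yes (yes _) _  = ≤-refl
  𝟙-yes (no ¬p) p  = contradiction p ¬p

sum-concatMap : ∀ {A : Set} (f : A → List ℕ) (xs : List A) →
                sum (concatMap f xs) ≡ sum (map (sum ∘ f) xs)
sum-concatMap f []       = refl
sum-concatMap f (x ∷ xs) = trans (sum-++ (f x) (concatMap f xs)) (cong (sum (f x) +_) (sum-concatMap f xs))

sum-allFin : ∀ n (f : ℕ → ℕ) → sum (map (f ∘ toℕ) (allFin n)) ≡ ∑< n f
sum-allFin n f = trans (cong sum (map-tabulate {n = n} (λ i → i) (f ∘ toℕ))) (sum-tabulate n f)
  where
  sum-tabulate : ∀ n (f : ℕ → ℕ) → sum (tabulate {n = n} (f ∘ toℕ)) ≡ ∑< n f
  sum-tabulate zero    f = refl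
  sum-tabulate (suc n) f = cong (f 0 +_) (sum-tabulate n (f ∘ suc))

does⇒ : ∀ {p} {P : Set p} (P? : Dec P) → does P? ≡ true → P
does⇒ (yes p) _ = p

module _ {R : Rel ℕ 0ℓ} (R? : Decidable R) (R-asym : Asymmetric R) where

  fromRelation : ∀ n → OrientedGraph n
  fromRelation n = record
    { arc      = λ u v → does (R? (toℕ u) (toℕ v))
    ; loopless = λ u → dec-false (R? (toℕ u) (toℕ u)) (λ r → R-asym r r)
    ; oriented = λ u v uv → dec-false (R? (toℕ v) (toℕ u)) (R-asym (does⇒ (R? (toℕ u) (toℕ v)) uv))
    }

  arcCount-fromRelation : ∀ n → arcCount (fromRelation n) ≡ ∑[ x < n ] ∑[ y < n ] 𝟙 (R? x y)
  arcCount-fromRelation n = begin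
    arcCount (fromRelation n)
      ≡⟨ sum-concatMap _ (allFin n) ⟩
    sum (map (λ u → sum (map (λ v → 𝟙 (R? (toℕ u) (toℕ v))) (allFin n))) (allFin n))
      ≡⟨ cong sum (map-cong (λ u → sum-allFin n (λ y → 𝟙 (R? (toℕ u) y))) (allFin n)) ⟩
    sum (map (λ u → ∑[ y < n ] 𝟙 (R? (toℕ u) y)) (allFin n))
      ≡⟨ sum-allFin n (λ x → ∑[ y < n ] 𝟙 (R? x y)) ⟩
    ∑[ x < n ] ∑[ y < n ] 𝟙 (R? x y)
      ∎
    where open ≡-Reasoning

Sk1-free-if-middles-labelled :
  ∀ {n} c (D : OrientedGraph n) →
  (label : ∀ {u x v} → arc D u x ≡ true → arc D x v ≡ true → Fin c) →
  (∀ {u x v u′ x′} (ux : arc D u x ≡ true) (xv : arc D x v ≡ true)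
     (u′x′ : arc D u′ x′ ≡ true) (x′v : arc D x′ v ≡ true) →
     label ux xv ≡ label u′x′ x′v → x ≡ x′) →
  Sk1-free (suc c) D
Sk1-free-if-middles-labelled c D label label-injective (f , f-injective , f-arc) =
  1+n≰n (injective⇒≤ g-injective)
  where
  g : Fin (suc c) → Fin c
  g i = label (f-arc _ _ (zw i)) (f-arc _ _ (wv i))
  w-injective : ∀ {i j} → SVert.w {suc c} i ≡ w j → i ≡ j
  w-injective refl = refl
  g-injective : Injective _≡_ _≡_ g
  g-injective gi≡gj = w-injective (f-injective (label-injective _ _ _ _ gi≡gj))

round-trip : ∀ x y p q {s t} → x + s ≡ p + y → y + t ≡ q + x → s + t ≡ p + q
round-trip x y p q {s} {t} xs≡py yt≡qx = +-cancelˡ-≡ (x + y) _ _ (begin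
  (x + y) + (s + t)  ≡⟨ interchange x y s t ⟩
  (x + s) + (y + t)  ≡⟨ cong₂ _+_ xs≡py yt≡qx ⟩
  (p + y) + (q + x)  ≡⟨ interchange′ p y q x ⟩
  (x + y) + (p + q)  ∎)
  where
  open ≡-Reasoning
  interchange : ∀ x y s t → (x + y) + (s + t) ≡ (x + s) + (y + t)
  interchange = solve-∀
  interchange′ : ∀ p y q x → (p + y) + (q + x) ≡ (x + y) + (p + q)
  interchange′ = solve-∀

-- B = {0, …, b-1} is the cycle and A = {b, …, b+a-1}; a successor y of x ∈ B is
-- reached either directly (Succ x y) or after passing b (Succ x (b + y)).
module Construction (a b c : ℕ) (c+c<b : c + c < b) where

  Succ : Rel ℕ 0ℓ
  Succ x y = Σ[ d ∈ Fin c ] x + suc (toℕ d) ≡ y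

  CycleArc : Rel ℕ 0ℓ
  CycleArc x y = Succ x y ⊎ Succ x (b + y)

  Arc : Rel ℕ 0ℓ
  Arc x y = b ≤ x × y < b ⊎ x < b × y < b × CycleArc x y

  succ? : Decidable Succ
  succ? x y = any? (λ d → x + suc (toℕ d) ≟ y)

  arc? : Decidable Arc
  arc? x y = b ≤? x ×-dec y <? b ⊎-dec x <? b ×-dec y <? b ×-dec (succ? x y ⊎-dec succ? x (b + y))

  c<b : c < b
  c<b = ≤-<-trans (m≤m+n c c) c+c<b

  two-offsets<b : ∀ (d e : Fin c) → suc (toℕ d) + suc (toℕ e) < b
  two-offsets<b d e = ≤-<-trans (+-mono-≤ (toℕ<n d) (toℕ<n e)) c+c<b

  -- A cycle of length two would have total offset 0, b or b + b.
  CycleArc-asym : Asymmetric CycleArc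
  CycleArc-asym {x} {y} (inj₁ (d , xy)) (inj₁ (e , yx)) with () ← round-trip x y 0 0 xy yx
  CycleArc-asym {x} {y} (inj₁ (d , xy)) (inj₂ (e , yx)) =
    <⇒≱ (two-offsets<b d e) (≤-reflexive (sym (round-trip x y 0 b xy yx)))
  CycleArc-asym {x} {y} (inj₂ (d , xy)) (inj₁ (e , yx)) =
    <⇒≱ (two-offsets<b d e) (≤-trans (m≤m+n b 0) (≤-reflexive (sym (round-trip x y b 0 xy yx))))
  CycleArc-asym {x} {y} (inj₂ (d , xy)) (inj₂ (e , yx)) =
    <⇒≱ (two-offsets<b d e) (≤-trans (m≤m+n b b) (≤-reflexive (sym (round-trip x y b b xy yx))))

  Arc-asym : Asymmetric Arc
  Arc-asym (inj₁ (_ , y<b))         (inj₁ (b≤y , _))         = <⇒≱ y<b b≤y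
  Arc-asym (inj₁ (b≤x , _))         (inj₂ (_ , x<b , _))     = <⇒≱ x<b b≤x
  Arc-asym (inj₂ (_ , y<b , _))     (inj₁ (b≤y , _))         = <⇒≱ y<b b≤y
  Arc-asym (inj₂ (_ , _ , xy))      (inj₂ (_ , _ , yx))      = CycleArc-asym xy yx

  D : OrientedGraph (b + a)
  D = fromRelation arc? Arc-asym (b + a)

  head<b : ∀ {x y} → Arc x y → y < b
  head<b (inj₁ (_ , y<b))     = y<b
  head<b (inj₂ (_ , y<b , _)) = y<b

  Arc⇒CycleArc : ∀ {x y} → x < b → Arc x y → CycleArc x y
  Arc⇒CycleArc x<b (inj₁ (b≤x , _))    = contradiction b≤x (<⇒≱ x<b)
  Arc⇒CycleArc _   (inj₂ (_ , _ , xy)) = xy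

  wrapped-source : ∀ {x x′ y s} → x + s ≡ y → x′ + s ≡ b + y → b ≤ x′
  wrapped-source {x} {x′} {y} {s} xs≡y x′s≡b+y = ≤-trans (m≤m+n b x) (≤-reflexive (sym x′≡b+x))
    where
    x′≡b+x : x′ ≡ b + x
    x′≡b+x = +-cancelʳ-≡ s x′ (b + x) (trans x′s≡b+y (trans (cong (b +_) (sym xs≡y)) (sym (+-assoc b x s))))

  offset : ∀ {x y} → CycleArc x y → Fin c
  offset = [ proj₁ , proj₁ ]

  offset-injective : ∀ {x x′ y} → x < b → x′ < b → (xy : CycleArc x y) (x′y : CycleArc x′ y) →
                     offset xy ≡ offset x′y → x ≡ x′
  offset-injective _ _ (inj₁ (d , xy)) (inj₁ (_ , x′y)) refl = +-cancelʳ-≡ _ _ _ (trans xy (sym x′y))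
  offset-injective _ _ (inj₂ (d , xy)) (inj₂ (_ , x′y)) refl = +-cancelʳ-≡ _ _ _ (trans xy (sym x′y))
  offset-injective _ x′<b (inj₁ (_ , xy)) (inj₂ (_ , x′y)) refl = contradiction (wrapped-source xy x′y) (<⇒≱ x′<b)
  offset-injective x<b _ (inj₂ (_ , xy)) (inj₁ (_ , x′y)) refl = contradiction (wrapped-source x′y xy) (<⇒≱ x<b)

  Succ-wrap-disjoint : ∀ {x y} → Succ x y → Succ x (b + y) → ⊥
  Succ-wrap-disjoint {x} {y} (d , xy) (e , xby) = <⇒≱ c<b (≤-trans b≤1+e (toℕ<n e))
    where
    1+e≡b+1+d : suc (toℕ e) ≡ b + suc (toℕ d)
    1+e≡b+1+d = +-cancelˡ-≡ x _ _ (trans xby (trans (cong (b +_) (sym xy)) (+-comm-assoc b x _)))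
      where
      +-comm-assoc : ∀ b x s → b + (x + s) ≡ x + (b + s)
      +-comm-assoc = solve-∀
    b≤1+e : b ≤ suc (toℕ e)
    b≤1+e = ≤-trans (m≤m+n b _) (≤-reflexive (sym 1+e≡b+1+d))

  D-Sk1-free : Sk1-free (suc c) D
  D-Sk1-free = Sk1-free-if-middles-labelled c D label label-injective
    where
    toArc : ∀ {u v} → arc D u v ≡ true → Arc (toℕ u) (toℕ v)
    toArc = does⇒ (arc? _ _)
    middle<b : ∀ {u x} → arc D u x ≡ true → toℕ x < b
    middle<b ux = head<b (toArc ux)
    cycleArc : ∀ {u x v} → arc D u x ≡ true → arc D x v ≡ true → CycleArc (toℕ x) (toℕ v)
    cycleArc ux xv = Arc⇒CycleArc (middle<b ux) (toArc xv)
    label : ∀ {u x v} → arc D u x ≡ true → arc D x v ≡ true → Fin c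
    label ux xv = offset (cycleArc ux xv)
    label-injective : ∀ {u x v u′ x′} (ux : arc D u x ≡ true) (xv : arc D x v ≡ true)
                      (u′x′ : arc D u′ x′ ≡ true) (x′v : arc D x′ v ≡ true) →
                      label ux xv ≡ label u′x′ x′v → x ≡ x′
    label-injective ux xv u′x′ x′v same-label = toℕ-injective
      (offset-injective (middle<b ux) (middle<b u′x′) (cycleArc ux xv) (cycleArc u′x′ x′v) same-label)

  outDegree : ℕ → ℕ
  outDegree x = ∑[ y < b + a ] 𝟙 (arc? x y)

  outDegree-A : ∀ {x} → b ≤ x → b ≤ outDegree x
  outDegree-A {x} b≤x = count-window (arc? x) 0 (m≤m+n b a) (λ y y<b → inj₁ (b≤x , y<b))

  successors-in-two-laps : ∀ {x} → x < b → c ≤ ∑[ y < b + b ] 𝟙 (succ? x y)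
  successors-in-two-laps {x} x<b = count-window (succ? x) (suc x) (+-mono-≤ x<b (<⇒≤ c<b)) successor
    where
    successor : ∀ j → j < c → Succ x (suc x + j)
    successor j j<c = fromℕ< j<c , trans (cong (λ i → x + suc i) (toℕ-fromℕ< j<c)) (+-suc x j)

  -- Unroll the cycle twice: each y < b is reached from x ∈ B as y or as b + y, never both.
  outDegree-B : ∀ {x} → x < b → c ≤ outDegree x
  outDegree-B {x} x<b = begin
    c                                                       ≤⟨ successors-in-two-laps x<b ⟩
    ∑[ y < b + b ] 𝟙 (succ? x y)                             ≡⟨ ∑-split b b _ ⟩
    ∑[ y < b ] 𝟙 (succ? x y) + ∑[ y < b ] 𝟙 (succ? x (b + y)) ≡⟨ sym (∑-distrib-+ b _ _) ⟩
    ∑[ y < b ] (𝟙 (succ? x y) + 𝟙 (succ? x (b + y)))         ≤⟨ ∑-mono-≤ b one-lap ⟩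
    ∑[ y < b ] 𝟙 (arc? x y)                                  ≤⟨ ∑-window 0 _ (m≤m+n b a) ⟩
    outDegree x                                             ∎
    where
    open ≤-Reasoning
    one-lap : ∀ y → y < b → 𝟙 (succ? x y) + 𝟙 (succ? x (b + y)) ≤ 𝟙 (arc? x y)
    one-lap y y<b = 𝟙-+-≤ (succ? x y) (succ? x (b + y)) (arc? x y)
      (λ s → inj₂ (x<b , y<b , inj₁ s)) (λ s → inj₂ (x<b , y<b , inj₂ s)) Succ-wrap-disjoint

  D-arcCount : b * c + a * b ≤ arcCount D
  D-arcCount = begin
    b * c + a * b
      ≤⟨ +-mono-≤ (∑-const-lower b (λ _ → outDegree-B)) (∑-const-lower a (λ i _ → outDegree-A (m≤m+n b i))) ⟩
    ∑< b outDegree + ∑[ i < a ] outDegree (b + i)  ≡⟨ sym (∑-split b a outDegree) ⟩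
    ∑< (b + a) outDegree                          ≡⟨ sym (arcCount-fromRelation arc? Arc-asym (b + a)) ⟩
    arcCount D                                    ∎
    where open ≤-Reasoning

⌈n/2⌉-parity : ∀ n → ⌈ n /2⌉ ≡ ⌊ n /2⌋ ⊎ ⌈ n /2⌉ ≡ suc ⌊ n /2⌋
⌈n/2⌉-parity zero          = inj₁ refl
⌈n/2⌉-parity (suc zero)    = inj₂ refl
⌈n/2⌉-parity (suc (suc n)) = Sum.map (cong suc) (cong suc) (⌈n/2⌉-parity n)

[n*n]/4≤⌊n/2⌋*⌈n/2⌉ : ∀ n → n * n / 4 ≤ ⌊ n /2⌋ * ⌈ n /2⌉
[n*n]/4≤⌊n/2⌋*⌈n/2⌉ n =
  m<1+n⇒m≤n (m<n*o⇒m/o<n (subst (λ m → m * m < suc (⌊ n /2⌋ * ⌈ n /2⌉) * 4) (⌊n/2⌋+⌈n/2⌉≡n n)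
    (square< ⌊ n /2⌋ ⌈ n /2⌉ (⌈n/2⌉-parity n))))
  where
  square< : ∀ p q → q ≡ p ⊎ q ≡ suc p → (p + q) * (p + q) < suc (p * q) * 4
  square< p _ (inj₁ refl) = ≤-trans (m≤m+n _ 3) (≤-reflexive (even p))
    where
    even : ∀ p → suc ((p + p) * (p + p)) + 3 ≡ suc (p * p) * 4
    even = solve-∀
  square< p _ (inj₂ refl) = ≤-trans (m≤m+n _ 2) (≤-reflexive (odd p))
    where
    odd : ∀ p → suc ((p + suc p) * (p + suc p)) + 2 ≡ suc (p * suc p) * 4
    odd = solve-∀

dense-Sk1-free-graph : ∀ n c → c + c < ⌊ n + c /2⌋ →
  Σ (OrientedGraph n) λ D → Sk1-free (suc c) D × (n + c) * (n + c) / 4 ≤ arcCount D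
dense-Sk1-free-graph n c c+c<b = subst Goal b+a≡n (D , D-Sk1-free , bound)
  where
  m = n + c
  b = ⌊ m /2⌋
  a = ⌈ m /2⌉ ∸ c

  Goal : ℕ → Set
  Goal N = Σ (OrientedGraph N) λ D → Sk1-free (suc c) D × m * m / 4 ≤ arcCount D

  c+a≡⌈m/2⌉ : c + a ≡ ⌈ m /2⌉
  c+a≡⌈m/2⌉ = m+[n∸m]≡n (≤-trans (m≤m+n c c) (≤-trans (<⇒≤ c+c<b) (⌊n/2⌋≤⌈n/2⌉ m)))

  b+a≡n : b + a ≡ n
  b+a≡n = +-cancelʳ-≡ c _ _ (begin
    b + a + c    ≡⟨ +-assoc b a c ⟩
    b + (a + c)  ≡⟨ cong (b +_) (trans (+-comm a c) c+a≡⌈m/2⌉) ⟩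
    b + ⌈ m /2⌉  ≡⟨ ⌊n/2⌋+⌈n/2⌉≡n m ⟩
    n + c        ∎)
    where open ≡-Reasoning

  open Construction a b c c+c<b

  bound : m * m / 4 ≤ arcCount D
  bound = begin
    m * m / 4      ≤⟨ [n*n]/4≤⌊n/2⌋*⌈n/2⌉ m ⟩
    b * ⌈ m /2⌉    ≡⟨ cong (b *_) (sym c+a≡⌈m/2⌉) ⟩
    b * (c + a)    ≡⟨ *-distribˡ-+ b c a ⟩
    b * c + b * a  ≡⟨ cong (b * c +_) (*-comm b a) ⟩
    b * c + a * b  ≤⟨ D-arcCount ⟩
    arcCount D     ∎
    where open ≤-Reasoning

lemma2p6 : (n k : ℕ) → k ≥ 2 → n ≥ 3 * k + 1 →
    Σ (OrientedGraph n) λ D →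
    Sk1-free k D × ((n + k ∸ 1) * (n + k ∸ 1)) / 4 ≤ arcCount D
lemma2p6 n (suc c) _ n≥3k+1 =
  map₂ (λ {D} → map₂ (subst (λ t → t * t / 4 ≤ arcCount D) (sym (cong (_∸ 1) (+-suc n c)))))
       (dense-Sk1-free-graph n c c+c<⌊n+c/2⌋)
  where
  c+c<⌊n+c/2⌋ : c + c < ⌊ n + c /2⌋
  c+c<⌊n+c/2⌋ = ≤-trans (n≤1+n _) (subst (_≤ ⌊ n + c /2⌋) (sym (n≡⌊n+n/2⌋ _)) (⌊n/2⌋-mono (begin
    suc (suc (c + c)) + suc (suc (c + c))  ≡⟨ four-c-plus-4 c ⟩
    3 * suc c + 1 + c                      ≤⟨ +-monoˡ-≤ c n≥3k+1 ⟩
    n + c                                  ∎)))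
    where
    open ≤-Reasoning
    four-c-plus-4 : ∀ c → suc (suc (c + c)) + suc (suc (c + c)) ≡ 3 * suc c + 1 + c
    four-c-plus-4 = solve-∀
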